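{- Let $\mathbb{K}$ be an infinite field, $\ell\geq 3$, and let $\mathcal{H}=(V,E)$ be a connected $\ell$-uniform hypergraph. Let $x,y\in V$ be distinct, and suppose there are edges $e,f\in E$ and $\sigma\in\mathrm{Sym}(\ell)$ such that $e^{\sigma}(1)=x$, $f(1)=y$, and $e^{\sigma}(a)=f(a)$ for all $a\in\{2,\dots,\ell\}$. Then $x\equiv_U y$; in particular $\bar{x}=\bar{y}$ in the frame $\mathfrak{F}(\mathcal{H})$.
   Context: Notation: $[\ell]=\{1,\dots,\ell\}$, $\mathrm{Sym}(\ell)$ is the symmetric group on $[\ell]$; for $f\in Y^{[\ell]}$ and $\sigma\in\mathrm{Sym}(\ell)$, $f^{\sigma}(a)=f(a^{\sigma})$. An $\ell$-uniform hypergraph is a pair $\mathcal{H}=(V,E)$ of finite sets where $E$ is a set of orbits of $V^{\ell}$ (functions $[\ell]\to V$) under this action; an edge $e$ is regarded via a chosen representative as an element of $V^{\ell}$, with $e^{\sigma}$ the other elements of its orbit. $\mathcal{H}$ is connected if any two vertices $x,y$ are joined by a walk $x=x_1,e_1,\dots,e_{m-1},x_m=y$ with, for each $i$, $e_i(a_i)=x_i$ and $e_i(b_i)=x_{i+1}$ for some $a_i,b_i\in[\ell]$. $U:\mathbb{K}^{\ell}\to\mathbb{K}$ is $U(\lambda)=\lambda(1)+\cdots+\lambda(\ell)$. A $U$-signal of $\mathcal{H}$ is a function $\delta:[\ell]\to\mathbb{K}^V$, $a\mapsto\delta_a$, such that for all $e\in E$ and $\tau\in\mathrm{Sym}(\ell)$,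 $\sum_{a\in[\ell]}\delta_a(e^{\tau}(a))=0$; $\mathrm{Der}(\mathcal{H},U)$ is the set of $U$-signals. The $U$-fusion relation on $V$ is: $x\equiv_U y$ iff $\delta_a(x)=\delta_a(y)$ for all $\delta\in\mathrm{Der}(\mathcal{H},U)$ and $a\in[\ell]$. The frame $\mathfrak{F}(\mathcal{H})$ is the quotient hypergraph $(\bar{V},\bar{E})$ where $\bar{V}$ is the set of $U$-fusion classes $\bar{x}$ and $\bar{E}=\{\bar{e}\mid e\in E\}$ with $\bar{e}(a)=\overline{e(a)}$. -}

module Defs where

open import Level using (Level; _⊔_; suc)
open import Data.Nat using (ℕ)
open import Data.Fin using (Fin)
open import Data.Fin.Permutation using (Permutation′; _⟨$⟩ʳ_)
open import Data.Product using (Σ; ∃; _×_)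
open import Relation.Binary.PropositionalEquality using (_≡_)
open import Relation.Binary.Construct.Closure.ReflexiveTransitive using (Star)
open import Relation.Nullary using (¬_)
open import Algebra.Bundles using (CommutativeRing)
import Algebra.Properties.CommutativeMonoid.Sum as SumProps

record Field (c ℓ : Level) : Set (suc (c ⊔ ℓ)) where
  field
    commutativeRing : CommutativeRing c ℓ
  open CommutativeRing commutativeRing public
  field
    0≉1     : ¬ (0# ≈ 1#)
    inverse : ∀ x → ¬ (x ≈ 0#) → ∃ λ y → x * y ≈ 1#

Infinite : ∀ {c ℓ} → Field c ℓ → Set (c ⊔ ℓ)
Infinite K = Σ (ℕ → Carrier) λ g → ∀ i j → g i ≈ g j → i ≡ j
  where open Field K

-- Edges (orbits of
-- V^ℓ under Sym ℓ) are given by a finite family of chosen representatives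
-- edge : Fin m → (Fin ℓ → Fin n).  Index [ℓ] = Fin ℓ, with 1 ↦ zero.
record Hypergraph (ℓ : ℕ) : Set where
  field
    n    : ℕ
    m    : ℕ
    edge : Fin m → Fin ℓ → Fin n
  V : Set
  V = Fin n
  E : Set
  E = Fin m

module _ {ℓ : ℕ} (H : Hypergraph ℓ) where
  open Hypergraph H

  act : (Fin ℓ → V) → Permutation′ ℓ → Fin ℓ → V
  act f σ a = f (σ ⟨$⟩ʳ a)

  Adjacent : V → V → Set
  Adjacent x y = Σ E λ e → Σ (Fin ℓ) λ a → Σ (Fin ℓ) λ b →
                   (edge e a ≡ x) × (edge e b ≡ y)

  Connected : Set
  Connected = ∀ x y → Star Adjacent x y

  module _ {c k : Level} (K : Field c k) where
    open Field K
    open SumProps +-commutativeMonoid using (sum)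

    IsUSignal : (Fin ℓ → V → Carrier) → Set k
    IsUSignal δ = ∀ (e : E) (τ : Permutation′ ℓ) →
                    sum (λ a → δ a (act (edge e) τ a)) ≈ 0#

    _≡U_ : V → V → Set (c ⊔ k)
    x ≡U y = ∀ (δ : Fin ℓ → V → Carrier) → IsUSignal δ →
               ∀ (a : Fin ℓ) → δ a x ≈ δ a y

-- Fix a U-signal δ and a position a, and let π swap a with the first position.
-- The tuples e^{πσ} and f^π agree at every position except a, where they read
-- x and y.  Both signal sums vanish, so comparing them leaves δ_a(x) = δ_a(y).
module Submission where

open import Defs
open import Level using (Level)
open import Algebra.Bundles using (CommutativeMonoid)
open import Data.Nat using (ℕ; _+_; suc)
open import Data.Fin using (Fin; zero; punchIn)
open import Data.Fin.Permutation
  using (Permutation′; _⟨$⟩ʳ_; _⟨$⟩ˡ_; _∘ₚ_; transpose; inverseˡ; inverseʳ)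
open import Data.Fin.Properties using (punchInᵢ≢i)
open import Data.Vec.Functional using (Vector; removeAt)
open import Relation.Binary.PropositionalEquality as ≡ using (_≡_; _≢_)
open import Relation.Nullary using (¬_)
import Algebra.Properties.CommutativeMonoid.Sum as CommutativeMonoidSum
import Algebra.Properties.CommutativeSemigroup as CommutativeSemigroupProperties
import Relation.Binary.Reasoning.Setoid as SetoidReasoning

module _ {c ℓ : Level} (M : CommutativeMonoid c ℓ) where
  open CommutativeMonoid M
  open CommutativeMonoidSum M using (sum; sum-remove; sum-cong-≋)
  open CommutativeSemigroupProperties commutativeSemigroup using (x∙yz≈y∙xz)
  open SetoidReasoning setoid

  sum-exchange : ∀ {n} (F G : Vector Carrier (suc n)) (a : Fin (suc n)) →
                 (∀ b → b ≢ a → F b ≈ G b) → F a ∙ sum G ≈ G a ∙ sum F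
  sum-exchange F G a F≈G-off-a = begin
    F a ∙ sum G                      ≈⟨ ∙-congˡ (sum-remove G) ⟩
    F a ∙ (G a ∙ sum (removeAt G a)) ≈⟨ x∙yz≈y∙xz (F a) (G a) _ ⟩
    G a ∙ (F a ∙ sum (removeAt G a)) ≈⟨ ∙-congˡ (∙-congˡ (sum-cong-≋ rest-agree)) ⟨
    G a ∙ (F a ∙ sum (removeAt F a)) ≈⟨ ∙-congˡ (sum-remove F) ⟨
    G a ∙ sum F                      ∎
    where
    rest-agree : ∀ i → removeAt F a i ≈ removeAt G a i
    rest-agree i = F≈G-off-a (punchIn a i) (punchInᵢ≢i a i)

  zero-sums-agree-at : ∀ {n} (F G : Vector Carrier (suc n)) (a : Fin (suc n)) →
                       (∀ b → b ≢ a → F b ≈ G b) →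
                       sum F ≈ ε → sum G ≈ ε → F a ≈ G a
  zero-sums-agree-at F G a F≈G-off-a ΣF≈ε ΣG≈ε = begin
    F a         ≈⟨ identityʳ (F a) ⟨
    F a ∙ ε     ≈⟨ ∙-congˡ ΣG≈ε ⟨
    F a ∙ sum G ≈⟨ sum-exchange F G a F≈G-off-a ⟩
    G a ∙ sum F ≈⟨ ∙-congˡ ΣF≈ε ⟩
    G a ∙ ε     ≈⟨ identityʳ (G a) ⟩
    G a         ∎

-- Both this lemma and πa≡1 below use that transpose a zero ⟨$⟩ˡ zero reduces to a.
transposeʳ-≢zero : ∀ {n} (a b : Fin (suc n)) → b ≢ a →
                   transpose a zero ⟨$⟩ʳ b ≢ zero
transposeʳ-≢zero a b b≢a πb≡0 =
  b≢a (≡.trans (≡.sym (inverseˡ (transpose a zero))) (≡.cong (transpose a zero ⟨$⟩ˡ_) πb≡0))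

module _ {ℓ : ℕ} (H : Hypergraph (suc ℓ)) {c k : Level} (K : Field c k) where
  open Hypergraph H
  open Field K using (Carrier; _≈_; refl; +-commutativeMonoid)

  signal-agrees-at : ∀ (δ : Fin (suc ℓ) → V → Carrier) → IsUSignal H K δ →
                     ∀ (e f : E) (ρ τ : Permutation′ (suc ℓ)) (a : Fin (suc ℓ)) →
                     (∀ b → b ≢ a → act H (edge e) ρ b ≡ act H (edge f) τ b) →
                     δ a (act H (edge e) ρ a) ≈ δ a (act H (edge f) τ a)
  signal-agrees-at δ δ-signal e f ρ τ a eρ≡fτ-off-a =
    zero-sums-agree-at +-commutativeMonoid
      (λ b → δ b (act H (edge e) ρ b)) (λ b → δ b (act H (edge f) τ b)) a
      (λ b b≢a → ≡.subst (λ v → δ b (act H (edge e) ρ b) ≈ δ b v)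
                       (eρ≡fτ-off-a b b≢a) refl)
      (δ-signal e ρ) (δ-signal f τ)

proposition8p1 : ∀ {c k : Level} (K : Field c k) → Infinite K →
    (j : ℕ) → (H : Hypergraph (3 + j)) → Connected H →
    (x y : Hypergraph.V H) → ¬ (x ≡ y) →
    (e f : Hypergraph.E H) (σ : Permutation′ (3 + j)) →
    act H (Hypergraph.edge H e) σ zero ≡ x →
    Hypergraph.edge H f zero ≡ y →
    (∀ (a : Fin (3 + j)) → ¬ (a ≡ zero) →
    act H (Hypergraph.edge H e) σ a ≡ Hypergraph.edge H f a) →
    _≡U_ H K x y
proposition8p1 K _ j H _ x y _ e f σ eσ₁≡x f₁≡y eσ≡f-off-1 δ δ-signal a =
  ≡.subst₂ (λ u v → δ a u ≈ δ a v)
    (≡.trans (≡.cong (act H (edge e) σ) πa≡1) eσ₁≡x)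
    (≡.trans (≡.cong (edge f) πa≡1) f₁≡y)
    (signal-agrees-at H K δ δ-signal e f (π ∘ₚ σ) π a
      (λ b b≢a → eσ≡f-off-1 (π ⟨$⟩ʳ b) (transposeʳ-≢zero a b b≢a)))
  where
  open Hypergraph H using (edge)
  open Field K using (_≈_)
  π : Permutation′ (3 + j)
  π = transpose a zero
  πa≡1 : π ⟨$⟩ʳ a ≡ zero
  πa≡1 = inverseʳ π
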